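{- Let $T\in\mathrm{SYT}(r\times 2)$ and let $M=\mathfrak M(T)$ be the noncrossing perfect matching of $[2r]$ in which each entry of the first column of $T$ is the smaller element of its pair. Let $o_1<\dots<o_k$ be the elements $i$ with $i<M(i)$ lying strictly between $1$ and $M(1)$, and let $c_{k+1}<\dots<c_{r-1}$ be the elements $i$ with $i>M(i)$ that are strictly larger than $M(1)$. Then $\mathrm{prom}_i(T)(1)=o_i$ for $1\le i\le k$ and $\mathrm{prom}_i(T)(1)=c_i$ for $k+1\le i\le r-1$.
   Context: $\mathrm{SYT}(r\times d)$ is the set of standard Young tableaux of rectangular shape with $r$ rows and $d$ columns, $n=rd$. Promotion $\partial(T)$: delete the entry 1, repeatedly slide into the empty box the smaller of the entries immediately right of or below it until the empty box is at the lower right corner, fill it with $n+1$ and subtract 1 from all entries. For $1\le i\le r-1$, $\mathrm{prom}_i(T)(j)\equiv a+j-1\pmod n$ (values in $[n]$), where $a$ is the unique entry moving from row $i+1$ to row $i$ when promotion is applied to $\partial^{j-1}(T)$. -}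

module Defs where

open import Data.Nat using (ℕ; zero; suc; _+_; _*_; _∸_; _<_; _≤_; _<ᵇ_; _≡ᵇ_; _%_)
open import Data.Bool using (Bool; true; false; if_then_else_; _∧_)
open import Data.List using (List; []; _∷_; map; upTo; filterᵇ; length)
open import Data.Maybe using (Maybe; just; nothing; fromMaybe)
import Data.Maybe as Maybe
open import Data.Product using (_×_; _,_)
open import Data.Empty using (⊥)
open import Relation.Binary.PropositionalEquality using (_≡_; _≢_)
open import Function using (_∘_)

-- A filling of the r × d rectangle: T i j is the entry in row i, column j
-- (both 0-indexed); values outside the rectangle are irrelevant.
Tab : Set
Tab = ℕ → ℕ → ℕ

record IsSYT (r d : ℕ) (T : Tab) : Set where
  field
    inRange : ∀ i j → i < r → j < d → 1 ≤ T i j × T i j ≤ r * d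
    distinct : ∀ i j i' j' → i < r → j < d → i' < r → j' < d →
               T i j ≡ T i' j' → (i ≡ i') × (j ≡ j')
    rowInc : ∀ i j → i < r → suc j < d → T i j < T i (suc j)
    colInc : ∀ i j → suc i < r → j < d → T i j < T (suc i) j

-- Jeu de taquin path of the empty box, starting at cell (i , j), with fuel.
-- The empty box moves into the smaller of the right / lower neighbour.
path : (r d : ℕ) → Tab → ℕ → ℕ → ℕ → List (ℕ × ℕ)
path r d T zero i j = (i , j) ∷ []
path r d T (suc f) i j with suc j <ᵇ d | suc i <ᵇ r
... | true  | true  = (i , j) ∷ (if T i (suc j) <ᵇ T (suc i) j
                                 then path r d T f i (suc j)
                                 else path r d T f (suc i) j)
... | true  | false = (i , j) ∷ path r d T f i (suc j)
... | false | true  = (i , j) ∷ path r d T f (suc i) j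
... | false | false = (i , j) ∷ []

slidePath : (r d : ℕ) → Tab → List (ℕ × ℕ)
slidePath r d T = path r d T (r + d) 0 0

slideVal : Tab → ℕ → List (ℕ × ℕ) → ℕ → ℕ → Maybe ℕ
slideVal T n [] x y = nothing
slideVal T n ((a , b) ∷ []) x y =
  if (a ≡ᵇ x) ∧ (b ≡ᵇ y) then just (suc n) else nothing
slideVal T n ((a , b) ∷ (c , e) ∷ rest) x y =
  if (a ≡ᵇ x) ∧ (b ≡ᵇ y) then just (T c e) else slideVal T n ((c , e) ∷ rest) x y

promotion : (r d : ℕ) → Tab → Tab
promotion r d T x y =
  fromMaybe (T x y) (slideVal T (r * d) (slidePath r d T) x y) ∸ 1

iter : ℕ → (Tab → Tab) → Tab → Tab
iter zero f T = T
iter (suc k) f T = f (iter k f T)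

-- Vertical moves along the path: (source row (0-indexed), entry moved up).
upMoves : Tab → List (ℕ × ℕ) → List (ℕ × ℕ)
upMoves T [] = []
upMoves T (_ ∷ []) = []
upMoves T ((i , j) ∷ (i' , j') ∷ rest) =
  if i <ᵇ i' then (i' , T i' j') ∷ upMoves T ((i' , j') ∷ rest)
  else upMoves T ((i' , j') ∷ rest)

lookupRow : ℕ → List (ℕ × ℕ) → Maybe ℕ
lookupRow k [] = nothing
lookupRow k ((i , v) ∷ rest) = if i ≡ᵇ k then just v else lookupRow k rest

-- The entry moving from (1-indexed) row i+1 to row i, i.e. from 0-indexed
-- row i to 0-indexed row i-1, when promotion is applied to T.
movingUp : (r d : ℕ) → ℕ → Tab → Maybe ℕ
movingUp r d i T = lookupRow i (upMoves T (slidePath r d T))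

wrap : ℕ → ℕ → ℕ
wrap zero m = m
wrap (suc k) m = suc ((m ∸ 1) % suc k)

-- prom_i(T)(j) for 1 ≤ i ≤ r-1, j ≥ 1 : a + j - 1 reduced into [n],
-- where a is the entry moving from row i+1 to row i in promotion of ∂^{j-1}(T).
prom : (r d : ℕ) → ℕ → Tab → ℕ → Maybe ℕ
prom r d i T j =
  Maybe.map (λ a → wrap (r * d) (a + j ∸ 1))
            (movingUp r d i (iter (j ∸ 1) (promotion r d) T))

record IsNCPerfectMatching (m : ℕ) (M : ℕ → ℕ) : Set where
  field
    closed : ∀ x → 1 ≤ x → x ≤ m → 1 ≤ M x × M x ≤ m
    noFix  : ∀ x → 1 ≤ x → x ≤ m → M x ≢ x
    invol  : ∀ x → 1 ≤ x → x ≤ m → M (M x) ≡ x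
    noncrossing : ∀ a b → 1 ≤ a → M b ≤ m → a < b → b < M a → M a < M b → ⊥

interval : ℕ → List ℕ
interval m = map suc (upTo m)

openersInside : ℕ → (ℕ → ℕ) → List ℕ
openersInside m M = filterᵇ (λ i → (1 <ᵇ i) ∧ (i <ᵇ M 1) ∧ (i <ᵇ M i)) (interval m)

closersAfter : ℕ → (ℕ → ℕ) → List ℕ
closersAfter m M = filterᵇ (λ i → (M 1 <ᵇ i) ∧ (M i <ᵇ i)) (interval m)

nth : List ℕ → ℕ → Maybe ℕ
nth [] _ = nothing
nth (x ∷ xs) zero = just x
nth (x ∷ xs) (suc k) = nth xs k

{-# OPTIONS --safe #-}
module Submission where

-- The r entries of column 0 are openers of M, so by counting column 0 holds exactly the
-- openers and column 1 exactly the closers; in particular M 1 = T K 1 for some row K.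
-- Noncrossing plus pigeonhole give T (p+1) 0 < T p 1 for p < K and T K 1 < T (K+1) 0,
-- so the promotion path of T runs down column 0 to row K, steps right and runs down
-- column 1: the entry moving up into row i is T i 0 for i ≤ K and T i 1 for i > K.
-- Finally, the openers strictly between 1 and M 1 are T 1 0 < ... < T K 0, and the
-- closers beyond M 1 are T (K+1) 1 < ... < T (r-1) 1.

open import Defs
open import Data.Bool using (true; false; if_then_else_; _∧_)
import Data.Bool as Bool
open import Data.Bool.Properties using (T-∧)
open import Data.Fin as Fin using (Fin; toℕ; fromℕ<; punchOut)
open import Data.Fin.Properties
  using (toℕ<n; toℕ-fromℕ<; toℕ-injective; injective⇒≤; punchOut-injective; any?)
open import Data.List using (List; []; _∷_; length; applyUpTo; filterᵇ)
open import Data.List.Properties using (length-applyUpTo)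
open import Data.List.Membership.Propositional using (_∈_)
open import Data.List.Membership.Propositional.Properties
  using (∈-map⁺; ∈-map⁻; ∈-upTo⁺; ∈-upTo⁻; ∈-filter⁺; ∈-filter⁻; ∈-applyUpTo⁺; ∈-applyUpTo⁻)
open import Data.List.Relation.Binary.Subset.Propositional using (_⊆_)
open import Data.List.Relation.Unary.All as All using (All)
open import Data.List.Relation.Unary.Any using (here; there)
open import Data.List.Relation.Unary.AllPairs using (AllPairs; []; _∷_)
import Data.List.Relation.Unary.AllPairs.Properties as AllPairs
open import Data.Maybe using (just)
import Data.Maybe as Maybe
open import Data.Nat
  using ( ℕ; zero; suc; NonZero; _+_; _*_; _∸_; _/_; _%_; _<_; _≤_; _<ᵇ_; _<?_; _≟_
        ; z≤n; s≤s; z<s; s≤s⁻¹)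
open import Data.Nat.Properties
open import Data.Nat.DivMod using (m≡m%n+[m/n]*n; m<n*o⇒m/o<n; m%n<n; m<n⇒m%n≡m)
open import Data.Product using (_×_; _,_; ∃; proj₁; proj₂; map₁)
open import Data.Sum using (_⊎_; inj₁; inj₂)
open import Function using (_∘_; id; Equivalence)
open import Function.Definitions using (Injective)
open import Relation.Nullary using (yes; no; contradiction)
open import Relation.Nullary.Decidable using (T?; dec-true; dec-false)
open import Relation.Binary.PropositionalEquality
  using (_≡_; _≢_; refl; sym; trans; cong; cong₂; subst; subst₂; module ≡-Reasoning)

Fin-injective⇒surjective : ∀ {n} {f : Fin n → Fin n} → Injective _≡_ _≡_ f →
  ∀ y → ∃ λ x → f x ≡ y
Fin-injective⇒surjective {suc n} {f} f-injective y with any? (λ x → f x Fin.≟ y)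
... | yes hit = hit
... | no miss = contradiction (injective⇒≤ punched-injective) (<-irrefl refl)
  where
  punched : Fin (suc n) → Fin n
  punched x = punchOut {i = y} λ y≡fx → miss (x , sym y≡fx)
  punched-injective : Injective _≡_ _≡_ punched
  punched-injective eq = f-injective (punchOut-injective {i = y} _ _ eq)

-- An injection [0, n) → [0, m) presented as a relation, so that existence proofs can
-- serve directly as its graph.
record InjectiveRelation (n m : ℕ) (R : ℕ → ℕ → Set) : Set where
  field
    image     : ∀ x → x < n → ∃ λ y → y < m × R x y
    injective : ∀ {x x′ y} → x < n → x′ < n → R x y → R x′ y → x ≡ x′

module AsFinFunction {n m R} (ρ : InjectiveRelation n m R) where
  open InjectiveRelation ρ

  choice : Fin n → Fin m
  choice x = fromℕ< (proj₁ (proj₂ (image (toℕ x) (toℕ<n x))))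

  choice-related : ∀ x → R (toℕ x) (toℕ (choice x))
  choice-related x with image (toℕ x) (toℕ<n x)
  ... | y , y<m , xRy = subst (R (toℕ x)) (sym (toℕ-fromℕ< y<m)) xRy

  choice-injective : Injective _≡_ _≡_ choice
  choice-injective {x} {x′} eq = toℕ-injective (injective (toℕ<n x) (toℕ<n x′)
    (choice-related x) (subst (R (toℕ x′)) (cong toℕ (sym eq)) (choice-related x′)))

open AsFinFunction

injectiveRelation⇒≤ : ∀ {n m R} → InjectiveRelation n m R → n ≤ m
injectiveRelation⇒≤ ρ = injective⇒≤ (choice-injective ρ)

-- Opaque because `with`-abstracting over an application would otherwise normalise the
-- whole pigeonhole argument, which is prohibitively expensive.
opaque
  injectiveRelation⇒onto : ∀ {n R} → InjectiveRelation n n R →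
    ∀ y → y < n → ∃ λ x → x < n × R x y
  injectiveRelation⇒onto {R = R} ρ y y<n
    with x , eq ← Fin-injective⇒surjective (choice-injective ρ) (fromℕ< y<n)
    = toℕ x , toℕ<n x
    , subst (R (toℕ x)) (trans (cong toℕ eq) (toℕ-fromℕ< y<n)) (choice-related ρ x)

module _ (f : ℕ → ℕ) {n : ℕ} (step : ∀ k → suc k < n → f k < f (suc k)) where

  increasing : ∀ {p q} → p < q → q < n → f p < f q
  increasing {p} {suc q} (s≤s p≤q) 1+q<n with m≤n⇒m<n∨m≡n p≤q
  ... | inj₁ p<q  = <-trans (increasing p<q (<-trans (n<1+n q) 1+q<n)) (step q 1+q<n)
  ... | inj₂ refl = step p 1+q<n

  nondecreasing : ∀ {p q} → p ≤ q → q < n → f p ≤ f q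
  nondecreasing p≤q q<n with m≤n⇒m<n∨m≡n p≤q
  ... | inj₁ p<q  = <⇒≤ (increasing p<q q<n)
  ... | inj₂ refl = ≤-refl

  increasing⁻¹ : ∀ {p q} → p < n → f p < f q → p < q
  increasing⁻¹ p<n fp<fq = ≰⇒> λ q≤p → <⇒≱ fp<fq (nondecreasing q≤p p<n)

module _ {r d : ℕ} {T : Tab} (syt : IsSYT r d T) where
  open IsSYT syt

  column-< : ∀ {j p q} → j < d → p < q → q < r → T p j < T q j
  column-< j<d = increasing (λ p → T p _) λ p 1+p<r → colInc p _ 1+p<r j<d

  column-≤ : ∀ {j p q} → j < d → p ≤ q → q < r → T p j ≤ T q j
  column-≤ j<d = nondecreasing (λ p → T p _) λ p 1+p<r → colInc p _ 1+p<r j<d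

  column-<⁻¹ : ∀ {j p q} → j < d → p < r → T p j < T q j → p < q
  column-<⁻¹ j<d = increasing⁻¹ (λ p → T p _) λ p 1+p<r → colInc p _ 1+p<r j<d

  row-≤ : ∀ {i j k} → i < r → j ≤ k → k < d → T i j ≤ T i k
  row-≤ i<r = nondecreasing (T _) λ j 1+j<d → rowInc _ j i<r 1+j<d

-- Position x of the row reading is the cell (x / d , x % d); values are shifted down by 1.
row-reading : ∀ {r d T} .{{_ : NonZero d}} → IsSYT r d T →
  InjectiveRelation (r * d) (r * d) λ x w → T (x / d) (x % d) ≡ suc w
row-reading {r} {d} {T} syt = record { image = image ; injective = injective }
  where
  open IsSYT syt
  image : ∀ x → x < r * d → ∃ λ w → w < r * d × T (x / d) (x % d) ≡ suc w
  image x x<rd with T (x / d) (x % d) | inRange (x / d) (x % d) (m<n*o⇒m/o<n x<rd) (m%n<n x d)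
  ... | suc w | _ , w<rd = w , w<rd , refl
  injective : ∀ {x x′ w} → x < r * d → x′ < r * d →
    T (x / d) (x % d) ≡ suc w → T (x′ / d) (x′ % d) ≡ suc w → x ≡ x′
  injective {x} {x′} x<rd x′<rd eq eq′
    with same-row , same-column ← distinct (x / d) (x % d) (x′ / d) (x′ % d)
      (m<n*o⇒m/o<n x<rd) (m%n<n x d) (m<n*o⇒m/o<n x′<rd) (m%n<n x′ d) (trans eq (sym eq′))
    = begin
    x                   ≡⟨ m≡m%n+[m/n]*n x d ⟩
    x % d + x / d * d   ≡⟨ cong₂ (λ j i → j + i * d) same-column same-row ⟩
    x′ % d + x′ / d * d ≡⟨ m≡m%n+[m/n]*n x′ d ⟨
    x′                  ∎
    where open ≡-Reasoning

entries-exhaust : ∀ {r d T} → IsSYT r d T →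
  ∀ {v} → 1 ≤ v → v ≤ r * d → ∃ λ i → ∃ λ j → i < r × j < d × T i j ≡ v
entries-exhaust {r} {zero} _ 1≤v v≤r*0 =
  contradiction (≤-trans 1≤v (≤-trans v≤r*0 (≤-reflexive (*-zeroʳ r)))) λ ()
entries-exhaust {r} {d@(suc _)} syt {suc w} _ w<rd
  with x , x<rd , eq ← injectiveRelation⇒onto (row-reading syt) w w<rd
  = x / d , x % d , m<n*o⇒m/o<n x<rd , m%n<n x d , eq

corner≡1 : ∀ {r d T} → IsSYT r d T → 0 < r → 0 < d → T 0 0 ≡ 1
corner≡1 {T = T} syt 0<r 0<d
  with i , j , i<r , j<d , Tij≡1 ← entries-exhaust syt ≤-refl (*-mono-≤ 0<r 0<d)
  = ≤-antisym
      (subst (T 0 0 ≤_) Tij≡1 (≤-trans (row-≤ syt 0<r z≤n j<d) (column-≤ syt j<d z≤n i<r)))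
      (proj₁ (IsSYT.inRange syt 0 0 0<r 0<d))

module _ {m M} (ncm : IsNCPerfectMatching m M) where
  open IsNCPerfectMatching ncm

  M-injective : ∀ {u v} → 1 ≤ u → u ≤ m → 1 ≤ v → v ≤ m → M u ≡ M v → u ≡ v
  M-injective 1≤u u≤m 1≤v v≤m eq =
    trans (sym (invol _ 1≤u u≤m)) (trans (cong M eq) (invol _ 1≤v v≤m))

  nested : ∀ {a b} → 1 ≤ a → a < b → b ≤ m → b < M a → M b < M a
  nested {a} {b} 1≤a a<b b≤m b<Ma = ≤∧≢⇒<
    (≮⇒≥ (noncrossing a b 1≤a (proj₂ (closed b 1≤b b≤m)) a<b b<Ma))
    (λ Mb≡Ma → <-irrefl (M-injective 1≤a (<⇒≤ (<-≤-trans a<b b≤m)) 1≤b b≤m (sym Mb≡Ma)) a<b)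
    where
    1≤b : 1 ≤ b
    1≤b = ≤-trans 1≤a (<⇒≤ a<b)

Increasing : List ℕ → Set
Increasing = AllPairs _<_

private
  head-≤ : ∀ {x xs v} → All (x <_) xs → v ∈ x ∷ xs → x ≤ v
  head-≤ _    (here refl)  = ≤-refl
  head-≤ x<xs (there v∈xs) = <⇒≤ (All.lookup x<xs v∈xs)

  tail-⊆ : ∀ {x xs ys} → All (x <_) xs → x ∷ xs ⊆ x ∷ ys → xs ⊆ ys
  tail-⊆ x<xs xs⊆ v∈xs with xs⊆ (there v∈xs)
  ... | here refl  = contradiction (All.lookup x<xs v∈xs) (<-irrefl refl)
  ... | there v∈ys = v∈ys

increasing-⊆-antisym : ∀ {xs ys} → Increasing xs → Increasing ys → xs ⊆ ys → ys ⊆ xs → xs ≡ ys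
increasing-⊆-antisym []           []           _   _   = refl
increasing-⊆-antisym []           (_ ∷ _)      _   ys⊆ with () ← ys⊆ (here refl)
increasing-⊆-antisym (_ ∷ _)      []           xs⊆ _   with () ← xs⊆ (here refl)
increasing-⊆-antisym (x<xs ∷ xs↗) (y<ys ∷ ys↗) xs⊆ ys⊆
  with refl ← ≤-antisym (head-≤ x<xs (ys⊆ (here refl))) (head-≤ y<ys (xs⊆ (here refl)))
  = cong (_ ∷_) (increasing-⊆-antisym xs↗ ys↗ (tail-⊆ x<xs xs⊆) (tail-⊆ y<ys ys⊆))

interval-increasing : ∀ m → Increasing (interval m)
interval-increasing m = AllPairs.map⁺ (AllPairs.applyUpTo⁺₁ id m λ i<j _ → s≤s i<j)

∈-interval⁺ : ∀ {m v} → 1 ≤ v → v ≤ m → v ∈ interval m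
∈-interval⁺ (s≤s z≤n) v≤m = ∈-map⁺ suc (∈-upTo⁺ v≤m)

∈-interval⁻ : ∀ {m v} → v ∈ interval m → 1 ≤ v × v ≤ m
∈-interval⁻ v∈ with _ , x∈ , refl ← ∈-map⁻ suc v∈ = s≤s z≤n , ∈-upTo⁻ x∈

filterᵇ-interval≡applyUpTo : ∀ {m P f L} →
  (∀ {i j} → i < j → j < L → f i < f j) →
  (∀ {v} → (1 ≤ v × v ≤ m) × Bool.T (P v) → ∃ λ j → j < L × v ≡ f j) →
  (∀ {j} → j < L → (1 ≤ f j × f j ≤ m) × Bool.T (P (f j))) →
  filterᵇ P (interval m) ≡ applyUpTo f L
filterᵇ-interval≡applyUpTo {m} {P} {f} {L} f-increasing sound complete =
  increasing-⊆-antisym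
    (AllPairs.filter⁺ (T? ∘ P) (interval-increasing m))
    (AllPairs.applyUpTo⁺₁ f L f-increasing)
    filtered⊆enumerated
    enumerated⊆filtered
  where
  filtered⊆enumerated : filterᵇ P (interval m) ⊆ applyUpTo f L
  filtered⊆enumerated v∈ with v∈interval , Pv ← ∈-filter⁻ (T? ∘ P) v∈
    with j , j<L , refl ← sound (∈-interval⁻ v∈interval , Pv) = ∈-applyUpTo⁺ f j<L
  enumerated⊆filtered : applyUpTo f L ⊆ filterᵇ P (interval m)
  enumerated⊆filtered v∈ with _ , j<L , refl ← ∈-applyUpTo⁻ f v∈
    with (1≤fj , fj≤m) , Pfj ← complete j<L = ∈-filter⁺ (T? ∘ P) (∈-interval⁺ 1≤fj fj≤m) Pfj

nth-applyUpTo : ∀ f {L j} → j < L → nth (applyUpTo f L) j ≡ just (f j)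
nth-applyUpTo f {suc L} {zero}  _         = refl
nth-applyUpTo f {suc L} {suc j} (s≤s j<L) = nth-applyUpTo (f ∘ suc) j<L

private
  upMoves-∷-path : ∀ {r d} Y f i j i′ j′ →
    upMoves Y ((i , j) ∷ path r d Y f i′ j′) ≡
      (if i <ᵇ i′ then (i′ , Y i′ j′) ∷ upMoves Y (path r d Y f i′ j′)
                  else upMoves Y (path r d Y f i′ j′))
  upMoves-∷-path         Y zero    i j i′ j′ = refl
  upMoves-∷-path {r} {d} Y (suc f) i j i′ j′ with suc j′ <ᵇ d | suc i′ <ᵇ r
  ... | true  | true  = refl
  ... | true  | false = refl
  ... | false | true  = refl
  ... | false | false = refl

module _ {r : ℕ} (Y : Tab) (f : ℕ) where

  path-right-down : ∀ {q} → suc q < r → path r 2 Y (suc f) q 1 ≡ (q , 1) ∷ path r 2 Y f (suc q) 1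
  path-right-down {q} 1+q<r rewrite dec-true (suc q <? r) 1+q<r = refl

  path-left-down : ∀ {p} → suc p < r → Y (suc p) 0 ≤ Y p 1 →
    path r 2 Y (suc f) p 0 ≡ (p , 0) ∷ path r 2 Y f (suc p) 0
  path-left-down {p} 1+p<r down
    rewrite dec-true (suc p <? r) 1+p<r | dec-false (Y p 1 <? Y (suc p) 0) (≤⇒≯ down) = refl

  upMoves-turn : ∀ {p} → suc p < r → Y p 1 < Y (suc p) 0 →
    upMoves Y (path r 2 Y (suc f) p 0) ≡ upMoves Y (path r 2 Y f p 1)
  upMoves-turn {p} 1+p<r across
    rewrite dec-true (suc p <? r) 1+p<r | dec-true (Y p 1 <? Y (suc p) 0) across
          | upMoves-∷-path {r} {2} Y f p 0 p 1 | dec-false (p <? p) (<-irrefl refl) = refl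

  lookupRow-down-here : ∀ i j →
    lookupRow (suc i) (upMoves Y ((i , j) ∷ path r 2 Y f (suc i) j)) ≡ just (Y (suc i) j)
  lookupRow-down-here i j
    rewrite upMoves-∷-path {r} {2} Y f i j (suc i) j
          | dec-true (i <? suc i) (n<1+n i) | dec-true (suc i ≟ suc i) refl = refl

  lookupRow-down-there : ∀ {k} i j → k ≢ suc i →
    lookupRow k (upMoves Y ((i , j) ∷ path r 2 Y f (suc i) j)) ≡
    lookupRow k (upMoves Y (path r 2 Y f (suc i) j))
  lookupRow-down-there {k} i j k≢1+i
    rewrite upMoves-∷-path {r} {2} Y f i j (suc i) j
          | dec-true (i <? suc i) (n<1+n i) | dec-false (suc i ≟ k) (k≢1+i ∘ sym) = refl

lookupRow-right-column : ∀ {r} Y f {q i} → r ≤ q + suc f → q < i → i < r →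
  lookupRow i (upMoves Y (path r 2 Y f q 1)) ≡ just (Y i 1)
lookupRow-right-column Y zero {q} fuel q<i i<r =
  contradiction (<-≤-trans i<r (≤-trans fuel (≤-reflexive (+-comm q 1)))) (<⇒≱ q<i ∘ s≤s⁻¹)
lookupRow-right-column {r} Y (suc f) {q} {i} fuel q<i i<r
  rewrite path-right-down Y f (≤-<-trans q<i i<r) with i ≟ suc q
... | yes refl = lookupRow-down-here Y f q 1
... | no i≢1+q = trans (lookupRow-down-there Y f q 1 i≢1+q)
  (lookupRow-right-column Y f (subst (r ≤_) (+-suc q (suc f)) fuel)
                              (≤∧≢⇒< q<i (i≢1+q ∘ sym)) i<r)

lookupRow-left-column : ∀ {r K} Y →
  (∀ {p} → p < K → Y (suc p) 0 < Y p 1) → (suc K < r → Y K 1 < Y (suc K) 0) →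
  ∀ f {p i} → p ≤ K → r ≤ p + f → p < i → i < r →
  (i ≤ K → lookupRow i (upMoves Y (path r 2 Y f p 0)) ≡ just (Y i 0)) ×
  (K < i → lookupRow i (upMoves Y (path r 2 Y f p 0)) ≡ just (Y i 1))
lookupRow-left-column Y _ _ zero {p} _ fuel p<i i<r =
  contradiction (<-≤-trans i<r (≤-trans fuel (≤-reflexive (+-identityʳ p)))) (<⇒≱ p<i ∘ <⇒≤)
lookupRow-left-column {r} {K} Y descends turns (suc f) {p} {i} p≤K fuel p<i i<r
  with m≤n⇒m<n∨m≡n p≤K
... | inj₂ refl rewrite upMoves-turn Y f (≤-<-trans p<i i<r) (turns (≤-<-trans p<i i<r)) =
  (λ i≤p → contradiction p<i (≤⇒≯ i≤p)) , (λ _ → lookupRow-right-column Y f fuel p<i i<r)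
... | inj₁ p<K rewrite path-left-down Y f (≤-<-trans p<i i<r) (<⇒≤ (descends p<K))
  with i ≟ suc p
...   | yes refl =
  (λ _ → lookupRow-down-here Y f p 0) , (λ K<1+p → contradiction p<K (≤⇒≯ (s≤s⁻¹ K<1+p)))
...   | no i≢1+p
  with left , right ← lookupRow-left-column Y descends turns f p<K (subst (r ≤_) (+-suc p f) fuel)
                                              (≤∧≢⇒< p<i (i≢1+p ∘ sym)) i<r =
  (λ i≤K → trans (lookupRow-down-there Y f p 0 i≢1+p) (left i≤K)) ,
  (λ K<i → trans (lookupRow-down-there Y f p 0 i≢1+p) (right K<i))

movingUp-two-columns : ∀ {r K Y} →
  (∀ {p} → p < K → Y (suc p) 0 < Y p 1) → (suc K < r → Y K 1 < Y (suc K) 0) →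
  ∀ {i} → 0 < i → i < r →
  (i ≤ K → movingUp r 2 i Y ≡ just (Y i 0)) × (K < i → movingUp r 2 i Y ≡ just (Y i 1))
movingUp-two-columns {r} descends turns =
  lookupRow-left-column _ descends turns (r + 2) z≤n (m≤m+n r 2)

wrap-id : ∀ {n a} → 1 ≤ a → a ≤ n → wrap n a ≡ a
wrap-id {suc n} {suc a} _ (s≤s a≤n) = cong suc (m<n⇒m%n≡m (s≤s a≤n))

prom-at-1 : ∀ {r d i Y a} → movingUp r d i Y ≡ just a → 1 ≤ a × a ≤ r * d →
  prom r d i Y 1 ≡ just a
prom-at-1 {r} {d} {a = a} moving (1≤a , a≤rd) =
  trans (cong (Maybe.map λ b → wrap (r * d) (b + 1 ∸ 1)) moving)
        (cong just (trans (cong (wrap (r * d)) (m+n∸n≡m a 1)) (wrap-id 1≤a a≤rd)))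

<ᵇ-∧⁻ : ∀ {m n b} → Bool.T ((m <ᵇ n) ∧ b) → m < n × Bool.T b
<ᵇ-∧⁻ = map₁ (<ᵇ⇒< _ _) ∘ Equivalence.to T-∧

<ᵇ-∧⁺ : ∀ {m n b} → m < n → Bool.T b → Bool.T ((m <ᵇ n) ∧ b)
<ᵇ-∧⁺ m<n Tb = Equivalence.from T-∧ (<⇒<ᵇ m<n , Tb)

module TwoColumn {r T M} (syt : IsSYT r 2 T) (ncm : IsNCPerfectMatching (2 * r) M)
                 (column₀-opens : ∀ p → p < r → T p 0 < M (T p 0)) where
  open IsSYT syt
  open IsNCPerfectMatching ncm

  0<2 : 0 < 2
  0<2 = z<s

  1<2 : 1 < 2
  1<2 = s≤s z<s

  entry-bounds : ∀ {p c} → p < r → c < 2 → 1 ≤ T p c × T p c ≤ 2 * r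
  entry-bounds p<r c<2 with 1≤ , ≤r*2 ← inRange _ _ p<r c<2 =
    1≤ , ≤-trans ≤r*2 (≤-reflexive (*-comm r 2))

  M∘M-bounded : ∀ {v} → 1 ≤ v × v ≤ 2 * r → M (M v) ≡ v
  M∘M-bounded (1≤v , v≤2r) = invol _ 1≤v v≤2r

  M-bounded : ∀ {v} → 1 ≤ v × v ≤ 2 * r → 1 ≤ M v × M v ≤ 2 * r
  M-bounded (1≤v , v≤2r) = closed _ 1≤v v≤2r

  columns-disjoint : ∀ {p q} → p < r → q < r → T p 0 ≢ T q 1
  columns-disjoint p<r q<r eq with () ← proj₂ (distinct _ _ _ _ p<r 0<2 q<r 1<2 eq)

  M-column-injective : ∀ {c p p′} → c < 2 → p < r → p′ < r → M (T p c) ≡ M (T p′ c) → p ≡ p′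
  M-column-injective c<2 p<r p′<r eq
    with 1≤u , u≤2r ← entry-bounds p<r c<2 | 1≤v , v≤2r ← entry-bounds p′<r c<2
    = proj₁ (distinct _ _ _ _ p<r c<2 p′<r c<2 (M-injective ncm 1≤u u≤2r 1≤v v≤2r eq))

  located : ∀ {v} → 1 ≤ v × v ≤ 2 * r → ∃ λ p → p < r × (T p 0 ≡ v ⊎ T p 1 ≡ v)
  located (1≤v , v≤2r) with entries-exhaust syt 1≤v (≤-trans v≤2r (≤-reflexive (*-comm 2 r)))
  ... | p , 0 , p<r , _ , eq = p , p<r , inj₁ eq
  ... | p , 1 , p<r , _ , eq = p , p<r , inj₂ eq
  ... | _ , suc (suc _) , _ , s≤s (s≤s ()) , _

  partner-of-column₀ : ∀ {p} → p < r → ∃ λ q → q < r × T q 1 ≡ M (T p 0)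
  partner-of-column₀ {p} p<r with located (M-bounded (entry-bounds p<r 0<2))
  ... | q , q<r , inj₂ eq = q , q<r , eq
  ... | q , q<r , inj₁ eq = contradiction (column₀-opens p p<r) (<⇒≯ (begin-strict
    M (T p 0)     ≡⟨ eq ⟨
    T q 0         <⟨ column₀-opens q q<r ⟩
    M (T q 0)     ≡⟨ cong M eq ⟩
    M (M (T p 0)) ≡⟨ M∘M-bounded (entry-bounds p<r 0<2) ⟩
    T p 0         ∎))
    where open ≤-Reasoning

  column₀-to-column₁ : InjectiveRelation r r λ p q → T q 1 ≡ M (T p 0)
  column₀-to-column₁ = record
    { image     = λ p p<r → partner-of-column₀ p<r
    ; injective = λ p<r p′<r eq eq′ → M-column-injective 0<2 p<r p′<r (trans (sym eq) eq′)
    }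

  partner-of-column₁ : ∀ {q} → q < r → ∃ λ p → p < r × M (T q 1) ≡ T p 0
  partner-of-column₁ {q} q<r
    with p , p<r , eq ← injectiveRelation⇒onto column₀-to-column₁ q q<r =
    p , p<r , trans (cong M eq) (M∘M-bounded (entry-bounds p<r 0<2))

  column₁-closes : ∀ {q} → q < r → M (T q 1) < T q 1
  column₁-closes {q} q<r with p , p<r , eq ← partner-of-column₁ q<r = begin-strict
    M (T q 1)     ≡⟨ eq ⟩
    T p 0         <⟨ column₀-opens p p<r ⟩
    M (T p 0)     ≡⟨ cong M eq ⟨
    M (M (T q 1)) ≡⟨ M∘M-bounded (entry-bounds q<r 1<2) ⟩
    T q 1         ∎
    where open ≤-Reasoning

  opener-in-column₀ : ∀ {v} → 1 ≤ v × v ≤ 2 * r → v < M v → ∃ λ p → p < r × T p 0 ≡ v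
  opener-in-column₀ bounds v<Mv with located bounds
  ... | p , p<r , inj₁ eq   = p , p<r , eq
  ... | q , q<r , inj₂ refl = contradiction v<Mv (<⇒≯ (column₁-closes q<r))

  closer-in-column₁ : ∀ {v} → 1 ≤ v × v ≤ 2 * r → M v < v → ∃ λ q → q < r × T q 1 ≡ v
  closer-in-column₁ bounds Mv<v with located bounds
  ... | q , q<r , inj₂ eq   = q , q<r , eq
  ... | p , p<r , inj₁ refl = contradiction Mv<v (<⇒≯ (column₀-opens p p<r))

  1-bounds : 0 < r → 1 ≤ 1 × 1 ≤ 2 * r
  1-bounds 0<r = ≤-refl , ≤-trans 0<r (m≤m+n r (r + 0))

  partner-of-1-in-column₁ : 0 < r → ∃ λ K → K < r × T K 1 ≡ M 1
  partner-of-1-in-column₁ 0<r =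
    closer-in-column₁ (M-bounded bounds) (subst (_< M 1) (sym (M∘M-bounded bounds)) 1<M1)
    where
    bounds : 1 ≤ 1 × 1 ≤ 2 * r
    bounds = 1-bounds 0<r
    1<M1 : 1 < M 1
    1<M1 = ≤∧≢⇒< (proj₁ (M-bounded bounds)) λ 1≡M1 → noFix 1 ≤-refl (proj₂ bounds) (sym 1≡M1)

  module PartnerOf1 {K} (K<r : K < r) (T-K1≡M1 : T K 1 ≡ M 1) where

    0<r : 0 < r
    0<r = ≤-<-trans z≤n K<r

    T00≡1 : T 0 0 ≡ 1
    T00≡1 = corner≡1 syt 0<r 0<2

    M-T-K1≡1 : M (T K 1) ≡ 1
    M-T-K1≡1 = trans (cong M T-K1≡M1) (M∘M-bounded (1-bounds 0<r))

    -- Otherwise T 1 0, ..., T (K+1) 0 are K+1 openers strictly inside (1, M 1); their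
    -- partners are closers below M 1 = T K 1, of which column 1 has only K.
    turns-right : suc K < r → T K 1 < T (suc K) 0
    turns-right 1+K<r with T K 1 <? T (suc K) 0
    ... | yes across = across
    ... | no ¬across = contradiction (injectiveRelation⇒≤ partners-inside) (<-irrefl refl)
      where
      below-M1 : T (suc K) 0 < M 1
      below-M1 = subst (T (suc K) 0 <_) T-K1≡M1
        (≤∧≢⇒< (≮⇒≥ ¬across) (columns-disjoint 1+K<r K<r))
      partners-inside : InjectiveRelation (suc K) K λ x y → T y 1 ≡ M (T (suc x) 0)
      partners-inside = record { image = image ; injective = injective }
        where
        image : ∀ x → x < suc K → ∃ λ y → y < K × T y 1 ≡ M (T (suc x) 0)
        image x x<1+K with q , q<r , eq ← partner-of-column₀ (≤-<-trans x<1+K 1+K<r) =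
          q , column-<⁻¹ syt 1<2 q<r (subst₂ _<_ (sym eq) (sym T-K1≡M1) inside) , eq
          where
          1+x<r : suc x < r
          1+x<r = ≤-<-trans x<1+K 1+K<r
          inside : M (T (suc x) 0) < M 1
          inside = nested ncm ≤-refl
            (subst (_< T (suc x) 0) T00≡1 (column-< syt 0<2 z<s 1+x<r))
            (proj₂ (entry-bounds 1+x<r 0<2))
            (≤-<-trans (column-≤ syt 0<2 x<1+K 1+K<r) below-M1)
        injective : ∀ {x x′ y} → x < suc K → x′ < suc K →
          T y 1 ≡ M (T (suc x) 0) → T y 1 ≡ M (T (suc x′) 0) → x ≡ x′
        injective x<1+K x′<1+K eq eq′ = suc-injective (M-column-injective 0<2
          (≤-<-trans x<1+K 1+K<r) (≤-<-trans x′<1+K 1+K<r) (trans (sym eq) eq′))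

    -- Otherwise the partners of T 0 1, ..., T p 1 are p+1 openers below T (p+1) 0 and
    -- different from 1 = M (T K 1), of which column 0 has only p.
    descends : ∀ {p} → p < K → T (suc p) 0 < T p 1
    descends {p} p<K with T (suc p) 0 <? T p 1
    ... | yes down = down
    ... | no ¬down = contradiction (injectiveRelation⇒≤ partners-above) (<-irrefl refl)
      where
      p<r : p < r
      p<r = <-trans p<K K<r
      partners-above : InjectiveRelation (suc p) p λ x y → M (T x 1) ≡ T (suc y) 0
      partners-above = record { image = image ; injective = injective }
        where
        image : ∀ x → x < suc p → ∃ λ y → y < p × M (T x 1) ≡ T (suc y) 0
        image x x<1+p with partner-of-column₁ (<-≤-trans x<1+p p<r)
        ... | zero , _ , eq = contradiction (<-≤-trans x<1+p p<K) (<-irrefl (M-column-injective 1<2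
          (<-≤-trans x<1+p p<r) K<r (trans eq (trans T00≡1 (sym M-T-K1≡1)))))
        ... | suc y , 1+y<r , eq = y , s≤s⁻¹ (column-<⁻¹ syt 0<2 1+y<r (begin-strict
          T (suc y) 0 ≡⟨ eq ⟨
          M (T x 1)   <⟨ column₁-closes (<-≤-trans x<1+p p<r) ⟩
          T x 1       ≤⟨ column-≤ syt 1<2 (s≤s⁻¹ x<1+p) p<r ⟩
          T p 1       ≤⟨ ≮⇒≥ ¬down ⟩
          T (suc p) 0 ∎)) , eq
          where open ≤-Reasoning
        injective : ∀ {x x′ y} → x < suc p → x′ < suc p →
          M (T x 1) ≡ T (suc y) 0 → M (T x′ 1) ≡ T (suc y) 0 → x ≡ x′
        injective x<1+p x′<1+p eq eq′ =
          M-column-injective 1<2 (<-≤-trans x<1+p p<r) (<-≤-trans x′<1+p p<r) (trans eq (sym eq′))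

    opener-between : ∀ {v} → 1 ≤ v × v ≤ 2 * r → 1 < v → v < M 1 → v < M v →
      ∃ λ j → j < K × v ≡ T (suc j) 0
    opener-between bounds 1<v v<M1 v<Mv with opener-in-column₀ bounds v<Mv
    ... | zero  , _     , refl = contradiction 1<v (<-irrefl (sym T00≡1))
    ... | suc j , 1+j<r , refl = j , ≰⇒> (<-asym v<M1 ∘ beyond-M1) , refl
      where
      beyond-M1 : K ≤ j → M 1 < T (suc j) 0
      beyond-M1 K≤j = subst (_< T (suc j) 0) T-K1≡M1
        (<-≤-trans (turns-right (≤-<-trans (s≤s K≤j) 1+j<r)) (column-≤ syt 0<2 (s≤s K≤j) 1+j<r))

    openersInside≡ : openersInside (2 * r) M ≡ applyUpTo (λ j → T (suc j) 0) K
    openersInside≡ = filterᵇ-interval≡applyUpTo enumeration-< sound complete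
      where
      Inside : ℕ → Bool.Bool
      Inside i = (1 <ᵇ i) ∧ (i <ᵇ M 1) ∧ (i <ᵇ M i)
      enumeration-< : ∀ {i j} → i < j → j < K → T (suc i) 0 < T (suc j) 0
      enumeration-< i<j j<K = column-< syt 0<2 (s≤s i<j) (≤-<-trans j<K K<r)
      sound : ∀ {v} → (1 ≤ v × v ≤ 2 * r) × Bool.T (Inside v) → ∃ λ j → j < K × v ≡ T (suc j) 0
      sound (bounds , inside) =
        let 1<v , inside′ = <ᵇ-∧⁻ inside ; v<M1 , v<Mv = <ᵇ-∧⁻ inside′
        in opener-between bounds 1<v v<M1 (<ᵇ⇒< _ _ v<Mv)
      complete : ∀ {j} → j < K →
        (1 ≤ T (suc j) 0 × T (suc j) 0 ≤ 2 * r) × Bool.T (Inside (T (suc j) 0))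
      complete {j} j<K = entry-bounds 1+j<r 0<2 ,
        <ᵇ-∧⁺ (subst (_< T (suc j) 0) T00≡1 (column-< syt 0<2 z<s 1+j<r))
          (<ᵇ-∧⁺ below-M1 (<⇒<ᵇ (column₀-opens (suc j) 1+j<r)))
        where
        1+j<r : suc j < r
        1+j<r = ≤-<-trans j<K K<r
        below-M1 : T (suc j) 0 < M 1
        below-M1 = subst (T (suc j) 0 <_) T-K1≡M1
          (≤-<-trans (column-≤ syt 0<2 j<K K<r) (rowInc K 0 K<r 1<2))

    length-openersInside : length (openersInside (2 * r) M) ≡ K
    length-openersInside = trans (cong length openersInside≡) (length-applyUpTo _ K)

    nth-openersInside : ∀ {j} → j < K → nth (openersInside (2 * r) M) j ≡ just (T (suc j) 0)
    nth-openersInside j<K = trans (cong (λ xs → nth xs _) openersInside≡) (nth-applyUpTo _ j<K)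

    below-r : ∀ {j} → j < r ∸ suc K → suc K + j < r
    below-r j<r-1-K = subst (_ <_) (m+[n∸m]≡n K<r) (+-monoʳ-< (suc K) j<r-1-K)

    closer-after : ∀ {v} → 1 ≤ v × v ≤ 2 * r → M 1 < v → M v < v →
      ∃ λ j → j < r ∸ suc K × v ≡ T (suc K + j) 1
    closer-after bounds M1<v Mv<v with q , q<r , refl ← closer-in-column₁ bounds Mv<v =
      q ∸ suc K , ∸-monoˡ-< q<r K<q , cong (λ row → T row 1) (sym (m+[n∸m]≡n K<q))
      where
      K<q : K < q
      K<q = column-<⁻¹ syt 1<2 K<r (subst (_< T q 1) (sym T-K1≡M1) M1<v)

    closersAfter≡ : closersAfter (2 * r) M ≡ applyUpTo (λ j → T (suc K + j) 1) (r ∸ suc K)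
    closersAfter≡ = filterᵇ-interval≡applyUpTo enumeration-< sound complete
      where
      After : ℕ → Bool.Bool
      After i = (M 1 <ᵇ i) ∧ (M i <ᵇ i)
      enumeration-< : ∀ {i j} → i < j → j < r ∸ suc K → T (suc K + i) 1 < T (suc K + j) 1
      enumeration-< i<j j< = column-< syt 1<2 (+-monoʳ-< (suc K) i<j) (below-r j<)
      sound : ∀ {v} → (1 ≤ v × v ≤ 2 * r) × Bool.T (After v) →
        ∃ λ j → j < r ∸ suc K × v ≡ T (suc K + j) 1
      sound (bounds , after) =
        let M1<v , Mv<v = <ᵇ-∧⁻ after in closer-after bounds M1<v (<ᵇ⇒< _ _ Mv<v)
      complete : ∀ {j} → j < r ∸ suc K →
        (1 ≤ T (suc K + j) 1 × T (suc K + j) 1 ≤ 2 * r) × Bool.T (After (T (suc K + j) 1))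
      complete {j} j< = entry-bounds (below-r j<) 1<2 ,
        <ᵇ-∧⁺ (subst (_< T (suc K + j) 1) T-K1≡M1 (column-< syt 1<2 (s≤s (m≤m+n K j)) (below-r j<)))
              (<⇒<ᵇ (column₁-closes (below-r j<)))

    nth-closersAfter : ∀ {q} → K < q → q < r →
      nth (closersAfter (2 * r) M) (q ∸ suc K) ≡ just (T q 1)
    nth-closersAfter {q} K<q q<r = begin
      nth (closersAfter (2 * r) M) (q ∸ suc K)
        ≡⟨ cong (λ xs → nth xs _) closersAfter≡ ⟩
      nth (applyUpTo (λ j → T (suc K + j) 1) (r ∸ suc K)) (q ∸ suc K)
        ≡⟨ nth-applyUpTo _ (∸-monoˡ-< q<r K<q) ⟩
      just (T (suc K + (q ∸ suc K)) 1)
        ≡⟨ cong (λ row → just (T row 1)) (m+[n∸m]≡n K<q) ⟩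
      just (T q 1) ∎
      where open ≡-Reasoning

    prom-at-1-column₀ : ∀ {q} → 0 < q → q ≤ K → q < r → prom r 2 q T 1 ≡ just (T q 0)
    prom-at-1-column₀ 0<q q≤K q<r = prom-at-1 {r} {2}
      (proj₁ (movingUp-two-columns descends turns-right 0<q q<r) q≤K) (inRange _ _ q<r 0<2)

    prom-at-1-column₁ : ∀ {q} → K < q → q < r → prom r 2 q T 1 ≡ just (T q 1)
    prom-at-1-column₁ K<q q<r = prom-at-1 {r} {2}
      (proj₂ (movingUp-two-columns descends turns-right (≤-<-trans z≤n K<q) q<r) K<q)
      (inRange _ _ q<r 1<2)

proposition3p2 : (r : ℕ) (T : Tab) → IsSYT r 2 T →
    (M : ℕ → ℕ) → IsNCPerfectMatching (2 * r) M →
    (∀ x → x < r → T x 0 < M (T x 0)) →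
    ∀ i → 1 ≤ i → i < r →
      (i ≤ length (openersInside (2 * r) M) →
        ∃ λ a → prom r 2 i T 1 ≡ just a × nth (openersInside (2 * r) M) (i ∸ 1) ≡ just a)
      × (length (openersInside (2 * r) M) < i →
        ∃ λ a → prom r 2 i T 1 ≡ just a
          × nth (closersAfter (2 * r) M) (i ∸ suc (length (openersInside (2 * r) M))) ≡ just a)
proposition3p2 r T syt M ncm column₀-opens (suc i) _ 1+i<r
  with K , K<r , T-K1≡M1
         ← TwoColumn.partner-of-1-in-column₁ syt ncm column₀-opens (≤-<-trans z≤n 1+i<r)
  rewrite TwoColumn.PartnerOf1.length-openersInside syt ncm column₀-opens K<r T-K1≡M1 =
    (λ 1+i≤K → T (suc i) 0 , prom-at-1-column₀ z<s 1+i≤K 1+i<r , nth-openersInside 1+i≤K)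
  , (λ K<1+i → T (suc i) 1 , prom-at-1-column₁ K<1+i 1+i<r , nth-closersAfter K<1+i 1+i<r)
  where
  open TwoColumn syt ncm column₀-opens
  open PartnerOf1 K<r T-K1≡M1
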